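{- Let $1\le p\le k\le m$ be integers and let $D$ be a collection of $N\ge 1$ strings (reads) over the alphabet $\{0,1,2,3\}$, each of length exactly $m$, so that the total size of $D$ is $n=Nm$. Apply minimum substring partitioning with parameters $k,p$ to every read of $D$. Let $l$ be the average number of breaks per read, i.e. $l=\frac{1}{N}\sum_{s\in D}(\text{number of super }k\text{ -mers of }s-1)$, and let $T$ be the total partition size, i.e. the sum of the lengths of all super $k$-mers of all reads. Then $T=\Theta\!\left(\frac{lk}{m}n+n\right)$: there are absolute constants $c_1,c_2>0$ (independent of $p,k,m,N,D$) such that $c_1\left(\frac{lk}{m}n+n\right)\le T\le c_2\left(\frac{lk}{m}n+n\right)$.
   Context: Strings of equal length over the alphabet $\{0,1,2,3\}$ (ordered $0<1<2<3$) are compared lexicographically. For a string $s=s_1\cdots s_m$, $s[i,j]$ denotes $s_i s_{i+1}\cdots s_j$. For a string $u$ of length at least $p$, its minimum $p$-substring $\min_p(u)$ is the lexicographically smallest length-$p$ substring of $u$ (as a string). The $k$-mers of $s$ are $s[i,i+k-1]$ for $i=1,\dots,m-k+1$. Minimum substring partitioning splits the sequence of $k$-mers of $s$ into maximal runs of consecutive $k$-mers $s[i,i+k-1],s[i+1,i+k],\dots,s[j-k+1,j]$ that all have the same minimum $p$-substring; each such run corresponds to the substring $s[i,j]$, called a super $k$-mer. Consecutive super $k$-mers of a read overlap in $k-1$ symbols; a break is a boundary between two consecutive super $k$-mers. -}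

module Defs where

open import Data.Nat using (ℕ; zero; suc; _+_; _*_; _∸_; _≤_; _<_)
open import Data.Fin using (Fin)
import Data.Fin as Fin
open import Data.Bool using (Bool; true; false; if_then_else_)
open import Data.List using (List; []; _∷_; take; drop; map; foldl; length; upTo)
open import Data.Nat.ListAction using (sum)
open import Data.Vec using (Vec; toList)
open import Relation.Nullary using (does)
import Data.List.Properties as LP

Sym : Set
Sym = Fin 4

Str : Set
Str = List Sym

lexLeq : Str → Str → Bool
lexLeq []       _        = true
lexLeq (_ ∷ _)  []       = false
lexLeq (a ∷ u)  (b ∷ v)  with does (a Fin.<? b) | does (a Fin.≟ b)
... | true  | _     = true
... | false | true  = lexLeq u v
... | false | false = false

lexMin : Str → Str → Str
lexMin x y = if lexLeq x y then x else y

-- s[i+1, i+len] with 0-based start i: the length-len substring starting at i.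
substr : ℕ → ℕ → Str → Str
substr i len u = take len (drop i u)

-- All length-p substrings of u (for length u ≥ p).
pSubstrings : ℕ → Str → List Str
pSubstrings p u = map (λ i → substr i p u) (upTo (suc (length u ∸ p)))

minSub : ℕ → Str → Str
minSub p u = foldl lexMin (substr 0 p u) (pSubstrings p u)

kmers : ℕ → Str → List Str
kmers k s = pSubstrings k s

strEq : Str → Str → Bool
strEq u v = does (LP.≡-dec Fin._≟_ u v)

runsFrom : Str → ℕ → List Str → List ℕ
runsFrom c n []       = n ∷ []
runsFrom c n (y ∷ ys) = if strEq c y then runsFrom c (suc n) ys else n ∷ runsFrom y 1 ys

runs : List Str → List ℕ
runs []       = []
runs (x ∷ xs) = runsFrom x 1 xs

-- Minimum substring partitioning: for each maximal run of r consecutive k-mers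
-- with the same minimum p-substring, the super k-mer has r k-mers, i.e. length r + k - 1.
-- superKmerRuns p k s = list of the numbers of k-mers in each super k-mer of s.
superKmerRuns : ℕ → ℕ → Str → List ℕ
superKmerRuns p k s = runs (map (minSub p) (kmers k s))

numSuperKmers : ℕ → ℕ → Str → ℕ
numSuperKmers p k s = length (superKmerRuns p k s)

superKmerLengths : ℕ → ℕ → Str → List ℕ
superKmerLengths p k s = map (λ r → r + (k ∸ 1)) (superKmerRuns p k s)

-- Total number of breaks over all reads: Σ_s (number of super k-mers of s − 1) = N·l.
totalBreaks : ∀ {m} → ℕ → ℕ → List (Vec Sym m) → ℕ
totalBreaks p k D = sum (map (λ s → numSuperKmers p k (toList s) ∸ 1) D)

totalSize : ∀ {m} → ℕ → ℕ → List (Vec Sym m) → ℕ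
totalSize p k D = sum (map (λ s → sum (superKmerLengths p k (toList s))) D)

module Submission where

-- For a read s of length m and k = K + 1 ≤ m, the sequence of
-- minimum p-substrings of its k-mers has L = m − K entries and is cut into
-- b + 1 maximal runs, b being the number of breaks.  The run lengths sum to L
-- and every super k-mer adds K symbols to its run length, so the partition
-- size of s is exactly
--     L + (b + 1)·K  =  b·K + m,
-- and b ≤ L ≤ m.  Summing over the N reads gives the exact identity
--     T = B·K + N·m   with   B ≤ N·m,
-- B the total number of breaks.  Hence T ≤ B·k + N·m ≤ 2T, i.e.
-- T = Θ(B·k + N·m) = Θ(lk n/m + n) with constants 1 and 2.

open import Defs
open import Data.Nat using (ℕ; zero; suc; _+_; _*_; _∸_; _≤_; _<_; s≤s; z≤n)
open import Data.Nat.Properties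
open import Data.Nat.ListAction using (sum)
open import Data.Nat.Tactic.RingSolver using (solve-∀)
open import Data.Fin using (Fin)
open import Data.Vec using (Vec; toList)
import Data.Vec.Properties as VP
open import Data.List using (List; []; _∷_; length; map; upTo)
import Data.List.Properties as LP
open import Data.Bool using (true; false)
open import Data.Product using (Σ; _×_; _,_; proj₁; proj₂)
open import Relation.Binary.PropositionalEquality

-- runsFrom c n ys decomposes a list whose current run (of value c) already has
-- n elements, followed by ys; the run lengths account for every element once.
runsFrom-sum : ∀ (c : Str) (n : ℕ) (ys : List Str) → sum (runsFrom c n ys) ≡ n + length ys
runsFrom-sum c n []       = refl
runsFrom-sum c n (y ∷ ys) with strEq c y
... | true  = trans (runsFrom-sum c (suc n) ys) (sym (+-suc n (length ys)))
... | false = cong (n +_) (runsFrom-sum y 1 ys)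

-- A nonempty list has at least one run, and at most one new run per
-- remaining element: the number of breaks is bounded by the list length.
runsFrom-breaks : ∀ (c : Str) (n : ℕ) (ys : List Str) →
  length (runsFrom c n ys) ≡ suc (length (runsFrom c n ys) ∸ 1)
  × length (runsFrom c n ys) ∸ 1 ≤ length ys
runsFrom-breaks c n []       = refl , z≤n
runsFrom-breaks c n (y ∷ ys) with strEq c y
... | true  = let (eq , le) = runsFrom-breaks c (suc n) ys in eq , m≤n⇒m≤1+n le
... | false = let (eq , le) = runsFrom-breaks y 1 ys in
              refl , subst (_≤ suc (length ys)) (sym eq) (s≤s le)

sum-map-+ : ∀ K (R : List ℕ) → sum (map (λ r → r + K) R) ≡ sum R + length R * K
sum-map-+ K []      = refl
sum-map-+ K (r ∷ R) = begin
  (r + K) + sum (map (λ r → r + K) R)  ≡⟨ cong ((r + K) +_) (sum-map-+ K R) ⟩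
  (r + K) + (sum R + length R * K)     ≡⟨ shuffle r K (sum R) (length R) ⟩
  (r + sum R) + suc (length R) * K     ∎
  where
  open ≡-Reasoning
  shuffle : ∀ r K s l → (r + K) + (s + l * K) ≡ (r + s) + suc l * K
  shuffle = solve-∀

runs-size : ∀ K (xs : List Str) → 0 < length xs →
  sum (map (λ r → r + K) (runs xs)) ≡ (length (runs xs) ∸ 1) * K + (length xs + K)
runs-size K (x ∷ xs) _ = begin
  sum (map (λ r → r + K) R)             ≡⟨ sum-map-+ K R ⟩
  sum R + length R * K                  ≡⟨ cong₂ (λ s l → s + l * K) (runsFrom-sum x 1 xs) lenR ⟩
  suc (length xs) + suc b * K           ≡⟨ regroup (suc (length xs)) b K ⟩
  b * K + (suc (length xs) + K)         ∎
  where
  open ≡-Reasoning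
  R : List ℕ
  R = runsFrom x 1 xs
  b : ℕ
  b = length R ∸ 1
  lenR : length R ≡ suc b
  lenR = proj₁ (runsFrom-breaks x 1 xs)
  regroup : ∀ L b K → L + suc b * K ≡ b * K + (L + K)
  regroup = solve-∀

runs-breaks : ∀ (xs : List Str) → length (runs xs) ∸ 1 ≤ length xs ∸ 1
runs-breaks []       = z≤n
runs-breaks (x ∷ xs) = proj₂ (runsFrom-breaks x 1 xs)

breaks : ℕ → ℕ → Str → ℕ
breaks p k s = numSuperKmers p k s ∸ 1

length-kmers : ∀ k (s : Str) → length (kmers k s) ≡ suc (length s ∸ k)
length-kmers k s = trans (LP.length-map _ (upTo (suc (length s ∸ k))))
                         (LP.length-upTo _)

read-size : ∀ p K (s : Str) → suc K ≤ length s →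
  sum (superKmerLengths p (suc K) s) ≡ breaks p (suc K) s * K + length s
read-size p K s k≤m = begin
  sum (map (λ r → r + K) (runs xs))     ≡⟨ runs-size K xs (subst (0 <_) (sym lenxs) (s≤s z≤n)) ⟩
  b * K + (length xs + K)               ≡⟨ cong (λ L → b * K + (L + K)) lenxs ⟩
  b * K + (suc (length s ∸ suc K) + K)  ≡⟨ cong (b * K +_) (+-suc (length s ∸ suc K) K) ⟨
  b * K + (length s ∸ suc K + suc K)    ≡⟨ cong (b * K +_) (m∸n+n≡m k≤m) ⟩
  b * K + length s                      ∎
  where
  open ≡-Reasoning
  xs : List Str
  xs = map (minSub p) (kmers (suc K) s)
  b : ℕ
  b = breaks p (suc K) s
  lenxs : length xs ≡ suc (length s ∸ suc K)
  lenxs = trans (LP.length-map (minSub p) (kmers (suc K) s)) (length-kmers (suc K) s)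

read-breaks-bound : ∀ p k (s : Str) → breaks p k s ≤ length s
read-breaks-bound p k s = begin
  breaks p k s         ≤⟨ runs-breaks xs ⟩
  length xs ∸ 1        ≡⟨ cong (_∸ 1) (trans (LP.length-map (minSub p) (kmers k s)) (length-kmers k s)) ⟩
  length s ∸ k         ≤⟨ m∸n≤m (length s) k ⟩
  length s             ∎
  where
  open ≤-Reasoning
  xs : List Str
  xs = map (minSub p) (kmers k s)

total-size : ∀ p K m (D : List (Vec (Fin 4) m)) → suc K ≤ m →
  totalSize p (suc K) D ≡ totalBreaks p (suc K) D * K + length D * m
total-size p K m []      k≤m = refl
total-size p K m (s ∷ D) k≤m = begin
  Tₛ + totalSize p (suc K) D           ≡⟨ cong₂ _+_ read-eq (total-size p K m D k≤m) ⟩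
  (b * K + m) + (B * K + length D * m) ≡⟨ regroup b B K (length D) m ⟩
  (b + B) * K + suc (length D) * m     ∎
  where
  open ≡-Reasoning
  Tₛ : ℕ
  Tₛ = sum (superKmerLengths p (suc K) (toList s))
  b : ℕ
  b = breaks p (suc K) (toList s)
  B : ℕ
  B = totalBreaks p (suc K) D
  read-eq : Tₛ ≡ b * K + m
  read-eq = trans (read-size p K (toList s) (subst (suc K ≤_) (sym (VP.length-toList s)) k≤m))
                  (cong (b * K +_) (VP.length-toList s))
  regroup : ∀ b B K N m → (b * K + m) + (B * K + N * m) ≡ (b + B) * K + suc N * m
  regroup = solve-∀

total-breaks-bound : ∀ p k m (D : List (Vec (Fin 4) m)) →
  totalBreaks p k D ≤ length D * m
total-breaks-bound p k m []      = z≤n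
total-breaks-bound p k m (s ∷ D) =
  +-mono-≤ (subst (breaks p k (toList s) ≤_) (VP.length-toList s) (read-breaks-bound p k (toList s)))
           (total-breaks-bound p k m D)

theta-bounds : ∀ B K n → B ≤ n →
  (B * suc K + n ≤ 2 * (B * K + n)) × (B * K + n ≤ B * suc K + n)
theta-bounds B K n B≤n = lower , upper
  where
  open ≤-Reasoning
  lower : B * suc K + n ≤ 2 * (B * K + n)
  lower = begin
    B * suc K + n             ≡⟨ expand B K n ⟩
    B + (B * K + n)           ≤⟨ +-monoˡ-≤ (B * K + n) (≤-trans B≤n (m≤n+m n (B * K))) ⟩
    (B * K + n) + (B * K + n) ≡⟨ double (B * K + n) ⟩
    2 * (B * K + n)           ∎
    where
    expand : ∀ B K n → B * suc K + n ≡ B + (B * K + n)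
    expand = solve-∀
    double : ∀ x → x + x ≡ 2 * x
    double = solve-∀
  upper : B * K + n ≤ B * suc K + n
  upper = +-monoˡ-≤ n (*-monoʳ-≤ B (n≤1+n K))

theorem3p1 : Σ ℕ λ a₁ → Σ ℕ λ b₁ → Σ ℕ λ a₂ → Σ ℕ λ b₂ →
    (0 < a₁ × 0 < b₁ × 0 < a₂ × 0 < b₂) ×
    ((p k m : ℕ) → (D : List (Vec (Fin 4) m)) →
      1 ≤ p → p ≤ k → k ≤ m → 1 ≤ length D →
      (a₁ * (totalBreaks p k D * k + length D * m) ≤ b₁ * totalSize p k D)
      × (b₂ * totalSize p k D ≤ a₂ * (totalBreaks p k D * k + length D * m)))
theorem3p1 = 1 , 2 , 1 , 1 , (s≤s z≤n , s≤s z≤n , s≤s z≤n , s≤s z≤n) , bounds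
  where
  bounds : (p k m : ℕ) → (D : List (Vec (Fin 4) m)) →
    1 ≤ p → p ≤ k → k ≤ m → 1 ≤ length D →
    (1 * (totalBreaks p k D * k + length D * m) ≤ 2 * totalSize p k D)
    × (1 * totalSize p k D ≤ 1 * (totalBreaks p k D * k + length D * m))
  bounds p zero m D (s≤s z≤n) () _ _
  bounds p (suc K) m D _ _ k≤m _ =
      subst₂ _≤_ (sym (*-identityˡ _)) (cong (2 *_) (sym T≡)) lower
    , subst₂ _≤_ (trans (sym T≡) (sym (*-identityˡ _))) (sym (*-identityˡ _)) upper
    where
    B n : ℕ
    B = totalBreaks p (suc K) D
    n = length D * m
    T≡ : totalSize p (suc K) D ≡ B * K + n
    T≡ = total-size p K m D k≤m
    lower : B * suc K + n ≤ 2 * (B * K + n)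
    lower = proj₁ (theta-bounds B K n (total-breaks-bound p (suc K) m D))
    upper : B * K + n ≤ B * suc K + n
    upper = proj₂ (theta-bounds B K n (total-breaks-bound p (suc K) m D))
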